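{- Let $E$ be a finite set, $r$ a nonnegative integer with $|E|\ge r$, $\mathcal{H}=\{H_1,\dots,H_q\}$ a collection of subsets of $E$, and $r_1,\dots,r_q$ nonnegative integers such that $|H_i\cap H_j|\le r_i+r_j-r$ for all $1\le i<j\le q$ and $|E\setminus H_i|+r_i\ge r$ for all $i=1,\dots,q$ (so that these data represent an elementary split matroid $M$ with independent sets $\{X\subseteq E: |X|\le r,\ |X\cap H_i|\le r_i \text{ for all } i\}$). Let $F\subseteq E$ with $|F|<r$. Then there is at most one index $i\in\{1,\dots,q\}$ such that $|F\cap H_i|=r_i$.
   Context: A set $F$ is called $H_i$-tight if $|F\cap H_i|=r_i$; the lemma says a set of size less than $r$ is tight with respect to at most one hyperedge. -}

module Defs where

open import Data.Nat using (ℕ; _+_; _∸_; _≤_)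
open import Data.Fin using (Fin; _<_)
open import Data.Fin.Subset using (Subset; _∩_; ∁; ∣_∣)

-- Elementary split matroid data conditions:
--  (1) |H_i ∩ H_j| ≤ r_i + r_j - r  for all i < j
--      (stated as |H_i ∩ H_j| + r ≤ r_i + r_j to avoid truncated subtraction)
--  (2) |E \ H_i| + r_i ≥ r  for all i
IsSplitData : (n r q : ℕ) → (Fin q → Subset n) → (Fin q → ℕ) → Set
IsSplitData n r q H rs =
  ((i j : Fin q) → i < j → ∣ H i ∩ H j ∣ + r ≤ rs i + rs j)
  × ((i : Fin q) → r ≤ ∣ ∁ (H i) ∣ + rs i)
  where open import Data.Product using (_×_)

Tight : {n q : ℕ} → (Fin q → Subset n) → (Fin q → ℕ) → Subset n → Fin q → Set
Tight H rs F i = ∣ F ∩ H i ∣ ≡ rs i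
  where open import Relation.Binary.PropositionalEquality using (_≡_)

{-# OPTIONS --safe #-}
-- If F were tight for two distinct hyperedges H_i and H_j, inclusion–exclusion
-- inside F would give r_i + r_j = |F ∩ H_i| + |F ∩ H_j| ≤ |F| + |H_i ∩ H_j|,
-- while the split condition gives |H_i ∩ H_j| + r ≤ r_i + r_j; hence r ≤ |F|.
module Submission where

open import Defs
open import Data.Nat using (ℕ; _+_; _≤_; _<_; suc)
open import Data.Nat.Properties
  using (+-suc; +-comm; +-mono-≤; +-monoˡ-<; <-irrefl; module ≤-Reasoning)
open import Data.Fin using (Fin)
open import Data.Fin.Properties using (<-cmp)
open import Data.Fin.Subset using (Subset; ∣_∣; _∩_; _∪_; _⊆_; inside; outside)
open import Data.Fin.Subset.Properties
  using (p⊆q⇒∣p∣≤∣q∣; p∩q⊆p; p∩q⊆q; x∈p∩q⁺; x∈p∩q⁻; ∩-distribˡ-∪)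
open import Data.Vec using ([]; _∷_)
open import Data.Product using (_,_)
open import Relation.Binary using (tri<; tri≈; tri>)
open import Relation.Binary.PropositionalEquality
  using (_≡_; refl; sym; trans; cong; cong₂; subst)
open import Relation.Nullary using (¬_)
open import Data.Empty using (⊥-elim)

∣p∪q∣+∣p∩q∣≡∣p∣+∣q∣ : ∀ {n} (p q : Subset n) → ∣ p ∪ q ∣ + ∣ p ∩ q ∣ ≡ ∣ p ∣ + ∣ q ∣
∣p∪q∣+∣p∩q∣≡∣p∣+∣q∣ []            []            = refl
∣p∪q∣+∣p∩q∣≡∣p∣+∣q∣ (outside ∷ p) (outside ∷ q) = ∣p∪q∣+∣p∩q∣≡∣p∣+∣q∣ p q
∣p∪q∣+∣p∩q∣≡∣p∣+∣q∣ (outside ∷ p) (inside  ∷ q) =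
  trans (cong suc (∣p∪q∣+∣p∩q∣≡∣p∣+∣q∣ p q)) (sym (+-suc ∣ p ∣ ∣ q ∣))
∣p∪q∣+∣p∩q∣≡∣p∣+∣q∣ (inside  ∷ p) (outside ∷ q) = cong suc (∣p∪q∣+∣p∩q∣≡∣p∣+∣q∣ p q)
∣p∪q∣+∣p∩q∣≡∣p∣+∣q∣ (inside  ∷ p) (inside  ∷ q) =
  cong suc (trans (+-suc ∣ p ∪ q ∣ ∣ p ∩ q ∣)
                  (trans (cong suc (∣p∪q∣+∣p∩q∣≡∣p∣+∣q∣ p q)) (sym (+-suc ∣ p ∣ ∣ q ∣))))

∣F∩A∣+∣F∩B∣≤∣F∣+∣A∩B∣ : ∀ {n} (F A B : Subset n) →
                        ∣ F ∩ A ∣ + ∣ F ∩ B ∣ ≤ ∣ F ∣ + ∣ A ∩ B ∣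
∣F∩A∣+∣F∩B∣≤∣F∣+∣A∩B∣ F A B = begin
  ∣ F ∩ A ∣ + ∣ F ∩ B ∣
    ≡⟨ sym (∣p∪q∣+∣p∩q∣≡∣p∣+∣q∣ (F ∩ A) (F ∩ B)) ⟩
  ∣ (F ∩ A) ∪ (F ∩ B) ∣ + ∣ (F ∩ A) ∩ (F ∩ B) ∣
    ≤⟨ +-mono-≤ (p⊆q⇒∣p∣≤∣q∣ union⊆F) (p⊆q⇒∣p∣≤∣q∣ meet⊆A∩B) ⟩
  ∣ F ∣ + ∣ A ∩ B ∣
    ∎
  where
  open ≤-Reasoning
  union⊆F : (F ∩ A) ∪ (F ∩ B) ⊆ F
  union⊆F = subst (_⊆ F) (∩-distribˡ-∪ F A B) (p∩q⊆p F (A ∪ B))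
  meet⊆A∩B : (F ∩ A) ∩ (F ∩ B) ⊆ A ∩ B
  meet⊆A∩B x∈ = let (x∈F∩A , x∈F∩B) = x∈p∩q⁻ (F ∩ A) (F ∩ B) x∈ in
    x∈p∩q⁺ (p∩q⊆q F A x∈F∩A , p∩q⊆q F B x∈F∩B)

tight-for-both⇒∣F∣≮r : ∀ {n q r} (H : Fin q → Subset n) (rs : Fin q → ℕ) (F : Subset n)
  (i j : Fin q) → ∣ H i ∩ H j ∣ + r ≤ rs i + rs j →
  Tight H rs F i → Tight H rs F j → ¬ ∣ F ∣ < r
tight-for-both⇒∣F∣≮r {r = r} H rs F i j split tightᵢ tightⱼ ∣F∣<r = <-irrefl refl (begin-strict
  rs i + rs j               ≡⟨ sym (cong₂ _+_ tightᵢ tightⱼ) ⟩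
  ∣ F ∩ H i ∣ + ∣ F ∩ H j ∣ ≤⟨ ∣F∩A∣+∣F∩B∣≤∣F∣+∣A∩B∣ F (H i) (H j) ⟩
  ∣ F ∣ + ∣ H i ∩ H j ∣     <⟨ +-monoˡ-< ∣ H i ∩ H j ∣ ∣F∣<r ⟩
  r + ∣ H i ∩ H j ∣         ≡⟨ +-comm r ∣ H i ∩ H j ∣ ⟩
  ∣ H i ∩ H j ∣ + r         ≤⟨ split ⟩
  rs i + rs j               ∎)
  where open ≤-Reasoning

lemma5p4 : (n r q : ℕ) → r ≤ n → (H : Fin q → Subset n) → (rs : Fin q → ℕ) →
    IsSplitData n r q H rs → (F : Subset n) → ∣ F ∣ < r →
    (i j : Fin q) → Tight H rs F i → Tight H rs F j → i ≡ j
lemma5p4 n r q _ H rs (split , _) F ∣F∣<r i j tightᵢ tightⱼ with <-cmp i j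
... | tri< i<j _ _ = ⊥-elim (tight-for-both⇒∣F∣≮r H rs F i j (split i j i<j) tightᵢ tightⱼ ∣F∣<r)
... | tri≈ _ i≡j _ = i≡j
... | tri> _ _ j<i = ⊥-elim (tight-for-both⇒∣F∣≮r H rs F j i (split j i j<i) tightⱼ tightᵢ ∣F∣<r)
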